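{- For every (finite, simple) graph $G$, we have $\mathit{eq}(L(G)) \le \sigma(G)$.
   Context: An equivalence graph is a disjoint union of cliques; an equivalence subgraph of a graph $H$ is a spanning-or-not subgraph of $H$ that is an equivalence graph. The equivalence number $\mathit{eq}(H)$ is the minimum number of equivalence subgraphs of $H$ whose union covers all edges of $H$. $L(G)$ denotes the line graph of $G$: its vertices are the edges of $G$, two being adjacent iff they share an endpoint. An orientation covering of $G$ is a set of orientations $\overrightarrow{G_1},\dots,\overrightarrow{G_k}$ of $G$ such that for every vertex $u$ and any two distinct neighbors $v,w$ of $u$, there is an $i$ with both arcs $\overrightarrow{uv}$ and $\overrightarrow{uw}$ in $\overrightarrow{G_i}$. The orientation covering number $\sigma(G)$ is the minimum size of an orientation covering of $G$. -}

module Defs where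

open import Data.Nat using (ℕ)
open import Data.Bool using (Bool; true; false; not)
open import Data.Fin using (Fin; _<_)
open import Data.Maybe using (Maybe; just)
open import Data.Product using (Σ; Σ-syntax; ∃-syntax; _×_; _,_; proj₁; proj₂)
open import Data.Sum using (_⊎_)
open import Relation.Binary.PropositionalEquality using (_≡_; _≢_)

record SimpleGraph (n : ℕ) : Set where
  field
    adj     : Fin n → Fin n → Bool
    symm    : ∀ u v → adj u v ≡ adj v u
    irrefl  : ∀ u → adj u u ≡ false

record Graph : Set₁ where
  field
    V   : Set
    Adj : V → V → Set

open SimpleGraph

Edge : ∀ {n} → SimpleGraph n → Set
Edge {n} G = Σ[ e ∈ Fin n × Fin n ] (proj₁ e < proj₂ e × adj G (proj₁ e) (proj₂ e) ≡ true)

ShareEnd : ∀ {n} {G : SimpleGraph n} → Edge G → Edge G → Set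
ShareEnd ((a , b) , _) ((c , d) , _) = (a ≡ c ⊎ a ≡ d) ⊎ (b ≡ c ⊎ b ≡ d)

LineGraph : ∀ {n} → SimpleGraph n → Graph
LineGraph G = record
  { V   = Edge G
  ; Adj = λ e f → e ≢ f × ShareEnd {G = G} e f }

-- An equivalence subgraph of H (a disjoint union of cliques contained in H):
-- given by a partial labelling of vertices by clique labels; the vertices
-- labelled `just i` form the clique with label i, and nothing else is in the
-- subgraph.
record EquivSubgraph (H : Graph) : Set where
  open Graph H
  field
    label    : V → Maybe ℕ
    isClique : ∀ x y i → x ≢ y → label x ≡ just i → label y ≡ just i → Adj x y

InEquivSubgraph : (H : Graph) → EquivSubgraph H → Graph.V H → Graph.V H → Set
InEquivSubgraph H S x y =
  ∃[ i ] (EquivSubgraph.label S x ≡ just i × EquivSubgraph.label S y ≡ just i)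

record EquivCovering (H : Graph) (m : ℕ) : Set where
  open Graph H
  field
    part   : Fin m → EquivSubgraph H
    covers : ∀ x y → Adj x y → ∃[ i ] InEquivSubgraph H (part i) x y

-- An orientation of G: `dir u v ≡ true` means the edge uv is oriented u → v;
-- on every edge exactly one direction is chosen.
record Orientation {n : ℕ} (G : SimpleGraph n) : Set where
  field
    dir    : Fin n → Fin n → Bool
    oneWay : ∀ u v → adj G u v ≡ true → dir v u ≡ not (dir u v)

Arc : ∀ {n} {G : SimpleGraph n} → Orientation G → Fin n → Fin n → Set
Arc {G = G} O u v = adj G u v ≡ true × Orientation.dir O u v ≡ true

record OrientationCovering {n : ℕ} (G : SimpleGraph n) (k : ℕ) : Set where
  field
    orient : Fin k → Orientation G
    covers : ∀ u v w → adj G u v ≡ true → adj G u w ≡ true → v ≢ w →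
             ∃[ i ] (Arc (orient i) u v × Arc (orient i) u w)

module Submission where

-- An orientation O of G determines, for every edge e of G, its
-- tail: the endpoint at which O orients e outwards.  Grouping the edges of G
-- by their tail gives an equivalence subgraph of L(G) (the "tail classes"):
-- two distinct edges with the same tail share that endpoint, so every class
-- is a clique of L(G).  Given an orientation covering O₁ … Oₖ, take the k
-- tail-class subgraphs.  They cover L(G): two adjacent vertices of L(G) are
-- distinct edges uv, uw of G with a common end u and v ≢ w (a "wedge"); the
-- covering provides an Oᵢ containing both arcs u → v and u → w, so both edges
-- have tail u in Oᵢ and lie in the same tail class.

open import Defs
open import Data.Nat using (ℕ; _≤_)
open import Data.Nat.Properties using (≤-refl; <-irrefl; <-trans; <-irrelevant)
open import Data.Bool using (true; false; if_then_else_)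
open import Data.Bool.Properties using () renaming (_≟_ to _≟ᵇ_)
open import Data.Fin using (Fin; toℕ)
open import Data.Fin.Properties using (toℕ-injective)
open import Data.Maybe using (just)
open import Data.Maybe.Properties using (just-injective)
open import Data.Product using (∃-syntax; _×_; _,_; proj₁; proj₂)
open import Data.Sum using (_⊎_; inj₁; inj₂)
open import Relation.Binary.PropositionalEquality
open import Axiom.UniquenessOfIdentityProofs using (module Decidable⇒UIP)

open SimpleGraph

module _ {n : ℕ} (G : SimpleGraph n) where

  _HasEnds_,_ : Edge G → Fin n → Fin n → Set
  ((a , b) , _) HasEnds u , v = (a ≡ u × b ≡ v) ⊎ (a ≡ v × b ≡ u)

  -- An edge is determined by its (ordered) endpoints: the order and
  -- adjacency proofs are propositions.
  edge-≡ : (e f : Edge G) → proj₁ (proj₁ e) ≡ proj₁ (proj₁ f) →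
           proj₂ (proj₁ e) ≡ proj₂ (proj₁ f) → e ≡ f
  edge-≡ ((a , b) , a<b , ab) ((.a , .b) , a<b′ , ab′) refl refl
    rewrite <-irrelevant a<b a<b′
          | Decidable⇒UIP.≡-irrelevant _≟ᵇ_ ab ab′ = refl

  ends-adjacent : (e : Edge G) → ∀ u v → e HasEnds u , v → adj G u v ≡ true
  ends-adjacent (_ , _ , ab) u v (inj₁ (refl , refl)) = ab
  ends-adjacent ((a , b) , _ , ab) u v (inj₂ (refl , refl)) = trans (symm G b a) ab

  tail : Orientation G → Edge G → Fin n
  tail O ((a , b) , _) = if Orientation.dir O a b then a else b

  tail-isEnd : ∀ O (e : Edge G) →
               tail O e ≡ proj₁ (proj₁ e) ⊎ tail O e ≡ proj₂ (proj₁ e)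
  tail-isEnd O ((a , b) , _) with Orientation.dir O a b
  ... | true  = inj₁ refl
  ... | false = inj₂ refl

  tail-of-arc : ∀ O (e : Edge G) u v → e HasEnds u , v → Arc O u v → tail O e ≡ u
  tail-of-arc O _ u v (inj₁ (refl , refl)) (_ , u→v) rewrite u→v = refl
  tail-of-arc O _ u v (inj₂ (refl , refl)) (uv , u→v)
    rewrite Orientation.oneWay O u v uv | u→v = refl

  same-tail⇒ShareEnd : ∀ O (e f : Edge G) → tail O e ≡ tail O f → ShareEnd {G = G} e f
  same-tail⇒ShareEnd O e f same with tail-isEnd O e | tail-isEnd O f
  ... | inj₁ p | inj₁ q = inj₁ (inj₁ (trans (sym p) (trans same q)))
  ... | inj₁ p | inj₂ q = inj₁ (inj₂ (trans (sym p) (trans same q)))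
  ... | inj₂ p | inj₁ q = inj₂ (inj₁ (trans (sym p) (trans same q)))
  ... | inj₂ p | inj₂ q = inj₂ (inj₂ (trans (sym p) (trans same q)))

  record Wedge (e f : Edge G) : Set where
    field
      centre outerₑ outer𝒻 : Fin n
      e-ends   : e HasEnds centre , outerₑ
      f-ends   : f HasEnds centre , outer𝒻
      distinct : outerₑ ≢ outer𝒻

  -- When the shared end sits in the same
  -- position of both edges, v ≡ w would make the edges equal; otherwise the
  -- ordering of endpoints (a < b, c < d) rules out v ≡ w.
  adjacent⇒Wedge : (e f : Edge G) → Graph.Adj (LineGraph G) e f → Wedge e f
  adjacent⇒Wedge e@((a , b) , _) f@((c , d) , _) (e≢f , inj₁ (inj₁ refl)) =
    record { e-ends = inj₁ (refl , refl) ; f-ends = inj₁ (refl , refl)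
           ; distinct = λ b≡d → e≢f (edge-≡ e f refl b≡d) }
  adjacent⇒Wedge ((a , b) , a<b , _) ((c , d) , c<d , _) (_ , inj₁ (inj₂ refl)) =
    record { e-ends = inj₁ (refl , refl) ; f-ends = inj₂ (refl , refl)
           ; distinct = λ { refl → <-irrefl refl (<-trans c<d a<b) } }
  adjacent⇒Wedge ((a , b) , a<b , _) ((c , d) , c<d , _) (_ , inj₂ (inj₁ refl)) =
    record { e-ends = inj₂ (refl , refl) ; f-ends = inj₁ (refl , refl)
           ; distinct = λ { refl → <-irrefl refl (<-trans a<b c<d) } }
  adjacent⇒Wedge e@((a , b) , _) f@((c , d) , _) (e≢f , inj₂ (inj₂ refl)) =
    record { e-ends = inj₂ (refl , refl) ; f-ends = inj₂ (refl , refl)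
           ; distinct = λ a≡c → e≢f (edge-≡ e f a≡c refl) }

  tailClasses : Orientation G → EquivSubgraph (LineGraph G)
  tailClasses O = record
    { label    = λ e → just (toℕ (tail O e))
    ; isClique = λ e f i e≢f eᵢ fᵢ →
        e≢f , same-tail⇒ShareEnd O e f
                (toℕ-injective (trans (just-injective eᵢ) (sym (just-injective fᵢ)))) }

  same-tail⇒together : ∀ O (e f : Edge G) → tail O e ≡ tail O f →
                       InEquivSubgraph (LineGraph G) (tailClasses O) e f
  same-tail⇒together O e f same = toℕ (tail O f) , cong (λ t → just (toℕ t)) same , refl

  tailClasses-cover : ∀ {k} (OC : OrientationCovering G k) (e f : Edge G) →
    Graph.Adj (LineGraph G) e f →
    ∃[ i ] InEquivSubgraph (LineGraph G) (tailClasses (OrientationCovering.orient OC i)) e f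
  tailClasses-cover OC e f e~f = together (adjacent⇒Wedge e f e~f)
    where
    open OrientationCovering OC
    together : Wedge e f → ∃[ i ] InEquivSubgraph (LineGraph G) (tailClasses (orient i)) e f
    together record { centre = u ; outerₑ = v ; outer𝒻 = w
                    ; e-ends = e-ends ; f-ends = f-ends ; distinct = v≢w }
      with i , u→v , u→w ← covers u v w (ends-adjacent e u v e-ends)
                                        (ends-adjacent f u w f-ends) v≢w
      = i , same-tail⇒together (orient i) e f
              (trans (tail-of-arc (orient i) e u v e-ends u→v)
                     (sym (tail-of-arc (orient i) f u w f-ends u→w)))

mainTheorem1 : ∀ {n : ℕ} (G : SimpleGraph n) (k : ℕ) →
    OrientationCovering G k → ∃[ m ] (m ≤ k × EquivCovering (LineGraph G) m)
mainTheorem1 G k OC = k , ≤-refl , record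
  { part   = λ i → tailClasses G (OrientationCovering.orient OC i)
  ; covers = tailClasses-cover G OC }
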